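{- Let $G$ be an Eulerian graph. Then there is a set of vertex-disjoint cycles of $G$ containing every vertex of maximum degree in $G$.
   Context: Graphs are finite and simple. A graph is Eulerian if every vertex has even degree (it need not be connected). -}

module Defs where

open import Data.Nat using (ℕ; zero; suc; _+_; _⊔_; _≤_)
open import Data.Bool using (Bool; true; false; if_then_else_)
open import Data.Fin using (Fin)
open import Data.List using (List; []; _∷_; _++_; [_]; map; foldr; allFin; length; concatMap)
open import Data.List.Relation.Unary.Unique.Propositional using (Unique)
open import Data.Nat.ListAction using (sum)
open import Data.Product using (∃; _×_)
open import Data.Unit using (⊤)
open import Relation.Binary.PropositionalEquality using (_≡_)

record Graph (n : ℕ) : Set where
  field
    Adj    : Fin n → Fin n → Bool
    sym    : ∀ u v → Adj u v ≡ Adj v u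
    irrefl : ∀ v → Adj v v ≡ false
open Graph public

Edge : ∀ {n} → Graph n → Fin n → Fin n → Set
Edge G u v = Adj G u v ≡ true

degree : ∀ {n} → Graph n → Fin n → ℕ
degree {n} G v = sum (map (λ u → if Adj G v u then 1 else 0) (allFin n))

-- maximum degree Δ(G) (0 for the empty graph)
maxDegree : ∀ {n} → Graph n → ℕ
maxDegree {n} G = foldr _⊔_ 0 (map (degree G) (allFin n))

data Even : ℕ → Set where
  even0  : Even 0
  even+2 : ∀ {k} → Even k → Even (suc (suc k))

-- Eulerian: every vertex has even degree (connectedness not required)
Eulerian : ∀ {n} → Graph n → Set
Eulerian {n} G = ∀ (v : Fin n) → Even (degree G v)

Walk : ∀ {n} → Graph n → List (Fin n) → Set
Walk G []           = ⊤
Walk G (u ∷ [])     = ⊤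
Walk G (u ∷ v ∷ vs) = Edge G u v × Walk G (v ∷ vs)

closeUp : ∀ {n} → List (Fin n) → List (Fin n)
closeUp []       = []
closeUp (v ∷ vs) = v ∷ vs ++ [ v ]

record Cycle {n} (G : Graph n) : Set where
  field
    vertices : List (Fin n)
    long     : 3 ≤ length vertices
    distinct : Unique vertices
    closed   : Walk G (closeUp vertices)
open Cycle public

VertexDisjoint : ∀ {n} {G : Graph n} → List (Cycle G) → Set
VertexDisjoint cs = Unique (concatMap vertices cs)

HasEdge : ∀ {n} → Graph n → Set
HasEdge {n} G = ∃ λ u → ∃ λ v → Edge G u v

{-# OPTIONS --safe #-}
-- Orient G so that in-degree equals out-degree at every vertex; such an orientation exists for every
-- Eulerian multigraph, by splitting off pairs of edges at a vertex. Every out-degree is then ⌊deg/2⌋ ≤ k = ⌊Δ/2⌋,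
-- and adding k − out-degree loops at each vertex gives a k-regular digraph, that is, a k-regular bipartite
-- multigraph. By Alon's argument (repeated Euler splitting of a 2^t-regular multigraph) it has a perfect
-- matching, which is a permutation σ of the vertices. A vertex of maximum degree carries no loop, so σ moves
-- it; σ sends every moved vertex along an arc of the orientation, and as G is simple, σ has no 2-cycles.
-- The orbits of σ through the moved vertices are the required vertex-disjoint cycles.

module Submission where

open import Defs hiding (sym)

open import Data.Bool using (true; false; if_then_else_)
open import Data.Empty using (⊥-elim)
open import Data.Fin using (Fin; zero; suc; _↑ˡ_; _↑ʳ_; splitAt; toℕ)
open import Data.Fin.Properties using (_≟_; any?; splitAt-↑ˡ; splitAt-↑ʳ; pigeonhole)
open import Data.List using (List; []; _∷_; _++_; [_]; applyUpTo; tabulate; foldr; map; allFin)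
open import Data.List.Membership.Propositional using (_∈_; _∉_)
open import Data.List.Membership.Propositional.Properties using (∈-applyUpTo⁺; ∈-applyUpTo⁻; ∈-map⁺; ∈-allFin)
open import Data.List.Properties using (length-applyUpTo; map-tabulate)
open import Data.List.Relation.Unary.All as All using (All; []; _∷_)
open import Data.List.Relation.Unary.AllPairs using ([])
open import Data.List.Relation.Unary.Any using (Any; here; there)
open import Data.List.Relation.Unary.Any.Properties using (concatMap⁻)
open import Data.List.Relation.Unary.Unique.Propositional using (Unique)
open import Data.List.Relation.Unary.Unique.Propositional.Properties using (applyUpTo⁺₁; ++⁺)
open import Data.Nat using (ℕ; zero; suc; pred; _+_; _*_; _^_; _∸_; _⊔_; _≤_; _<_; z≤n; s≤s; ⌊_/2⌋; NonZero; >-nonZero)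
open import Data.Nat.DivMod using (_/_; _%_; m≡m%n+[m/n]*n; m%n<n)
open import Data.Nat.GeneralisedArithmetic using (iterate)
open import Data.Nat.Induction using (<-rec)
import Data.Nat.ListAction as ListAction
open import Data.Nat.Properties hiding (_≟_)
open import Data.Nat.Solver using (module +-*-Solver)
open import Data.Product using (Σ; ∃; _×_; _,_; proj₁; proj₂)
open import Data.Sum using (_⊎_; inj₁; inj₂)
open import Data.Unit using (tt)
open import Function using (_∘_; id)
open import Function.Definitions using (Injective)
open import Relation.Binary.PropositionalEquality hiding ([_])
open import Relation.Nullary using (¬_; yes; no)
open import Relation.Nullary.Decidable using (_×-dec_)
open import Relation.Unary using (Decidable)

open import Algebra.Properties.CommutativeSemigroup +-commutativeSemigroup using (interchange; xy∙z≈xz∙y)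
open import Algebra.Properties.Semiring.Sum +-*-semiring
  using (sum; sum-cong-≗; ∑-distrib-+; *-distribˡ-sum; sum-replicate-zero)

private
  variable
    m : ℕ

δ : Fin m → Fin m → ℕ
δ zero    zero    = 1
δ zero    (suc _) = 0
δ (suc _) zero    = 0
δ (suc a) (suc b) = δ a b

δ-refl : (a : Fin m) → δ a a ≡ 1
δ-refl zero    = refl
δ-refl (suc a) = δ-refl a

δ-≢ : {a b : Fin m} → a ≢ b → δ a b ≡ 0
δ-≢ {a = zero}  {zero}  a≢b = ⊥-elim (a≢b refl)
δ-≢ {a = zero}  {suc b} a≢b = refl
δ-≢ {a = suc a} {zero}  a≢b = refl
δ-≢ {a = suc a} {suc b} a≢b = δ-≢ (a≢b ∘ cong suc)

δ-sym : (a b : Fin m) → δ a b ≡ δ b a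
δ-sym zero    zero    = refl
δ-sym zero    (suc b) = refl
δ-sym (suc a) zero    = refl
δ-sym (suc a) (suc b) = δ-sym a b

∑-δ : (f : Fin m → ℕ) (a : Fin m) → sum (λ x → f x * δ x a) ≡ f a
∑-δ {suc m} f zero = begin
  f zero * 1 + sum (λ i → f (suc i) * 0) ≡⟨ cong₂ _+_ (*-identityʳ (f zero)) (sum-cong-≗ (*-zeroʳ ∘ f ∘ suc)) ⟩
  f zero + sum {m} (λ _ → 0)              ≡⟨ cong (f zero +_) (sum-replicate-zero m) ⟩
  f zero + 0                              ≡⟨ +-identityʳ (f zero) ⟩
  f zero                                  ∎
  where open ≡-Reasoning
∑-δ {suc m} f (suc a) = cong₂ _+_ (*-zeroʳ (f zero)) (∑-δ (f ∘ suc) a)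

sum-δ : (a : Fin m) → sum (λ x → δ x a) ≡ 1
sum-δ a = trans (sum-cong-≗ (λ x → sym (*-identityˡ (δ x a)))) (∑-δ (λ _ → 1) a)

term≤sum : (f : Fin m → ℕ) (i : Fin m) → f i ≤ sum f
term≤sum f zero    = m≤m+n (f zero) _
term≤sum f (suc i) = ≤-trans (term≤sum (f ∘ suc) i) (m≤n+m _ (f zero))

terms≤sum : (f : Fin m → ℕ) {i j : Fin m} → i ≢ j → f i + f j ≤ sum f
terms≤sum f {zero}  {zero}  i≢j = ⊥-elim (i≢j refl)
terms≤sum f {zero}  {suc j} i≢j = +-monoʳ-≤ (f zero) (term≤sum (f ∘ suc) j)
terms≤sum f {suc i} {zero}  i≢j =
  subst (_≤ sum f) (+-comm (f zero) (f (suc i))) (+-monoʳ-≤ (f zero) (term≤sum (f ∘ suc) i))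
terms≤sum f {suc i} {suc j} i≢j =
  ≤-trans (terms≤sum (f ∘ suc) (i≢j ∘ cong suc)) (m≤n+m _ (f zero))

sum≡0⇒≡0 : (f : Fin m → ℕ) → sum f ≡ 0 → ∀ i → f i ≡ 0
sum≡0⇒≡0 f ∑f≡0 i = n≤0⇒n≡0 (subst (f i ≤_) ∑f≡0 (term≤sum f i))

sum>0⇒∃>0 : (f : Fin m → ℕ) → 0 < sum f → ∃ λ i → 0 < f i
sum>0⇒∃>0 {suc m} f ∑f>0 with f zero in f0
... | suc _ = zero , subst (0 <_) (sym f0) (s≤s z≤n)
... | zero  with i , fi>0 ← sum>0⇒∃>0 (f ∘ suc) ∑f>0 = suc i , fi>0

sum-const : ∀ m c → sum {m} (λ _ → c) ≡ m * c
sum-const zero    c = refl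
sum-const (suc m) c = cong (c +_) (sum-const m c)

even-2⁻ : ∀ {n} → Even (suc (suc n)) → Even n
even-2⁻ (even+2 e) = e

+-double-suc : ∀ n d → n + (suc d + suc d) ≡ suc (suc (n + (d + d)))
+-double-suc n d = trans (+-suc n _) (cong suc (trans (cong (n +_) (+-suc d d)) (+-suc n (d + d))))

even-+-double⁺ : ∀ {n} → Even n → ∀ d → Even (n + (d + d))
even-+-double⁺ {n} e zero    = subst Even (sym (+-identityʳ n)) e
even-+-double⁺ {n} e (suc d) = subst Even (sym (+-double-suc n d)) (even+2 (even-+-double⁺ e d))

even-+-double⁻ : ∀ n d → Even (n + (d + d)) → Even n
even-+-double⁻ n zero    e = subst Even (+-identityʳ n) e
even-+-double⁻ n (suc d) e = even-+-double⁻ n d (even-2⁻ (subst Even (+-double-suc n d) e))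

even-suc⇒pos : ∀ {n} → Even (suc n) → 0 < n
even-suc⇒pos {zero}  ()
even-suc⇒pos {suc n} _ = s≤s z≤n

-- Digraphs, and multigraphs when symmetric, as ℕ-valued adjacency matrices

Matrix : ℕ → Set
Matrix m = Fin m → Fin m → ℕ

infixl 6 _⊕_ _⊖_
infix 4 _≐_

_⊕_ _⊖_ : Matrix m → Matrix m → Matrix m
(M ⊕ N) x y = M x y + N x y
(M ⊖ N) x y = M x y ∸ N x y

record _≐_ (M N : Matrix m) : Set where
  constructor pointwise
  field ≐-at : ∀ x y → M x y ≡ N x y

≐-refl : {M : Matrix m} → M ≐ M
≐-refl = pointwise λ _ _ → refl

≐-sym : {M N : Matrix m} → M ≐ N → N ≐ M
≐-sym (pointwise e) = pointwise λ x y → sym (e x y)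

rowSum colSum : Matrix m → Fin m → ℕ
rowSum M x = sum (M x)
colSum M y = sum (λ x → M x y)

total : Matrix m → ℕ
total M = sum (rowSum M)

record Symmetric (M : Matrix m) : Set where
  constructor symmetric
  field symmetric-at : ∀ x y → M x y ≡ M y x

record Loopless (M : Matrix m) : Set where
  constructor loopless
  field loopless-at : ∀ x → M x x ≡ 0

rowSum-cong : {M N : Matrix m} → M ≐ N → ∀ x → rowSum M x ≡ rowSum N x
rowSum-cong (pointwise e) x = sum-cong-≗ (e x)

colSum-cong : {M N : Matrix m} → M ≐ N → ∀ y → colSum M y ≡ colSum N y
colSum-cong (pointwise e) y = sum-cong-≗ (λ x → e x y)

rowSum-⊕ : (M N : Matrix m) → ∀ x → rowSum (M ⊕ N) x ≡ rowSum M x + rowSum N x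
rowSum-⊕ M N x = ∑-distrib-+ (M x) (N x)

colSum-⊕ : (M N : Matrix m) → ∀ y → colSum (M ⊕ N) y ≡ colSum M y + colSum N y
colSum-⊕ M N y = ∑-distrib-+ (λ x → M x y) (λ x → N x y)

⊖-⊕ : {M N : Matrix m} → (∀ x y → N x y ≤ M x y) → (M ⊖ N) ⊕ N ≐ M
⊖-⊕ N≤M = pointwise λ x y → m∸n+n≡m (N≤M x y)

opaque
  arc : Fin m → Fin m → Matrix m
  arc a b x y = δ x a * δ y b

link : Fin m → Fin m → Matrix m
link a b = arc a b ⊕ arc b a

opaque
  unfolding arc

  rowSum-arc : (a b x : Fin m) → rowSum (arc a b) x ≡ δ x a
  rowSum-arc a b x = ∑-δ (λ _ → δ x a) b

  colSum-arc : (a b y : Fin m) → colSum (arc a b) y ≡ δ y b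
  colSum-arc a b y = trans (sum-cong-≗ (λ x → *-comm (δ x a) (δ y b))) (∑-δ (λ _ → δ y b) a)

  arc-transpose : (a b x y : Fin m) → arc a b y x ≡ arc b a x y
  arc-transpose a b x y = *-comm (δ y a) (δ x b)

  arc-on : (a b : Fin m) → arc a b a b ≡ 1
  arc-on a b = cong₂ _*_ (δ-refl a) (δ-refl b)

  arc-off : {a b x y : Fin m} → ¬ (x ≡ a × y ≡ b) → arc a b x y ≡ 0
  arc-off {a = a} {b} {x} {y} off with x ≟ a | y ≟ b
  ... | yes refl | yes refl = ⊥-elim (off (refl , refl))
  ... | no x≢a   | _        = cong (_* δ y b) (δ-≢ x≢a)
  ... | yes _    | no y≢b   = trans (cong (δ x a *_) (δ-≢ y≢b)) (*-zeroʳ (δ x a))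

rowSum-link : (a b x : Fin m) → rowSum (link a b) x ≡ δ x a + δ x b
rowSum-link a b x = trans (rowSum-⊕ (arc a b) (arc b a) x) (cong₂ _+_ (rowSum-arc a b x) (rowSum-arc b a x))

arc-≤ : {M : Matrix m} {a b : Fin m} → 1 ≤ M a b → ∀ x y → arc a b x y ≤ M x y
arc-≤ {M = M} {a} {b} Mab≥1 x y with x ≟ a ×-dec y ≟ b
... | yes (refl , refl) = subst (_≤ M x y) (sym (arc-on x y)) Mab≥1
... | no off            = subst (_≤ M x y) (sym (arc-off off)) z≤n

link-≤ : {M : Matrix m} {a b : Fin m} → Symmetric M → a ≢ b → 1 ≤ M a b →
         ∀ x y → link a b x y ≤ M x y
link-≤ {M = M} {a} {b} (symmetric M-sym) a≢b Mab≥1 x y with x ≟ a ×-dec y ≟ b | x ≟ b ×-dec y ≟ a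
... | yes (refl , refl) | _ =
  subst (_≤ M x y) (sym (cong₂ _+_ (arc-on x y) (arc-off (a≢b ∘ proj₁)))) Mab≥1
... | no _ | yes (refl , refl) =
  subst (_≤ M x y) (sym (cong₂ _+_ (arc-off (a≢b ∘ proj₂)) (arc-on x y))) (subst (1 ≤_) (M-sym a b) Mab≥1)
... | no off₁ | no off₂ = subst (_≤ M x y) (sym (cong₂ _+_ (arc-off off₁) (arc-off off₂))) z≤n

link-symmetric : (a b : Fin m) → Symmetric (link a b)
link-symmetric a b = symmetric λ x y →
  trans (+-comm (arc a b x y) _) (sym (cong₂ _+_ (arc-transpose a b x y) (arc-transpose b a x y)))

link-loopless : {a b : Fin m} → a ≢ b → Loopless (link a b)
link-loopless a≢b = loopless λ x → cong₂ _+_ (arc-off λ (x≡a , x≡b) → a≢b (trans (sym x≡a) x≡b))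
                                (arc-off λ (x≡b , x≡a) → a≢b (trans (sym x≡a) x≡b))

⊕-symmetric : {M N : Matrix m} → Symmetric M → Symmetric N → Symmetric (M ⊕ N)
⊕-symmetric (symmetric M-sym) (symmetric N-sym) = symmetric λ x y → cong₂ _+_ (M-sym x y) (N-sym x y)

⊖-symmetric : {M N : Matrix m} → Symmetric M → Symmetric N → Symmetric (M ⊖ N)
⊖-symmetric (symmetric M-sym) (symmetric N-sym) = symmetric λ x y → cong₂ _∸_ (M-sym x y) (N-sym x y)

⊕-loopless : {M N : Matrix m} → Loopless M → Loopless N → Loopless (M ⊕ N)
⊕-loopless (loopless M-loop) (loopless N-loop) = loopless λ x → cong₂ _+_ (M-loop x) (N-loop x)

⊖-loopless : {M : Matrix m} (N : Matrix m) → Loopless M → Loopless (M ⊖ N)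
⊖-loopless N (loopless M-loop) = loopless λ x → trans (cong (_∸ N x x) (M-loop x)) (0∸n≡0 (N x x))

-- Balanced orientations of Eulerian multigraphs

record Orients (O W : Matrix m) : Set where
  constructor orients
  field orients-at : ∀ x y → O x y + O y x ≡ W x y

record Circulation (O : Matrix m) : Set where
  constructor circulation
  field circulation-at : ∀ x → rowSum O x ≡ colSum O x

-- a unit flow from a to b: out-degree minus in-degree is δ x a − δ x b
record Flow (O : Matrix m) (a b : Fin m) : Set where
  constructor flow
  field flow-at : ∀ x → rowSum O x + δ x b ≡ colSum O x + δ x a

BalancedOrientation : Matrix m → Set
BalancedOrientation W = ∃ λ O → Orients O W × Circulation O

orients-cong : {O O′ W W′ : Matrix m} → O ≐ O′ → W ≐ W′ → Orients O W → Orients O′ W′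
orients-cong (pointwise O≐O′) (pointwise W≐W′) (orients o) =
  orients λ x y → trans (sym (cong₂ _+_ (O≐O′ x y) (O≐O′ y x))) (trans (o x y) (W≐W′ x y))

orients-⊕ : {O O′ W W′ : Matrix m} → Orients O W → Orients O′ W′ → Orients (O ⊕ O′) (W ⊕ W′)
orients-⊕ {O = O} {O′} (orients o) (orients o′) =
  orients λ x y → trans (interchange (O x y) (O′ x y) (O y x) (O′ y x)) (cong₂ _+_ (o x y) (o′ x y))

orients-cancel : {O O′ W W′ : Matrix m} → Orients (O ⊕ O′) (W ⊕ W′) → Orients O′ W′ → Orients O W
orients-cancel {O = O} {O′} {W} {W′} (orients o) (orients o′) = orients λ x y → +-cancelʳ-≡ (W′ x y) _ _ (begin
  (O x y + O y x) + W′ x y              ≡⟨ cong (O x y + O y x +_) (sym (o′ x y)) ⟩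
  (O x y + O y x) + (O′ x y + O′ y x)   ≡⟨ interchange (O x y) (O y x) (O′ x y) (O′ y x) ⟩
  (O x y + O′ x y) + (O y x + O′ y x)   ≡⟨ o x y ⟩
  W x y + W′ x y                        ∎)
  where open ≡-Reasoning

arc-orients : (a b : Fin m) → Orients (arc a b) (link a b)
arc-orients a b = orients λ x y → cong (arc a b x y +_) (arc-transpose a b x y)

circulation-cong : {O O′ : Matrix m} → O ≐ O′ → Circulation O → Circulation O′
circulation-cong O≐O′ (circulation c) =
  circulation λ x → trans (sym (rowSum-cong O≐O′ x)) (trans (c x) (colSum-cong O≐O′ x))

circulation⇒flow : {O : Matrix m} → Circulation O → ∀ a → Flow O a a
circulation⇒flow (circulation c) a = flow λ x → cong (_+ δ x a) (c x)

flow⇒circulation : {O : Matrix m} {a : Fin m} → Flow O a a → Circulation O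
flow⇒circulation {a = a} (flow f) = circulation λ x → +-cancelʳ-≡ (δ x a) _ _ (f x)

arc-flow : (a b : Fin m) → Flow (arc a b) a b
arc-flow a b = flow λ x → trans (cong₂ _+_ (rowSum-arc a b x) (sym (colSum-arc a b x))) (+-comm (δ x a) _)

telescope : ∀ r r′ s s′ a b c → r + b ≡ s + a → r′ + c ≡ s′ + b → r + r′ + c ≡ s + s′ + a
telescope r r′ s s′ a b c e e′ = +-cancelʳ-≡ b _ _ (begin
  r + r′ + c + b       ≡⟨ solve 4 (λ r r′ c b → r :+ r′ :+ c :+ b := (r :+ b) :+ (r′ :+ c)) refl r r′ c b ⟩
  (r + b) + (r′ + c)   ≡⟨ cong₂ _+_ e e′ ⟩
  (s + a) + (s′ + b)   ≡⟨ solve 4 (λ s s′ a b → (s :+ a) :+ (s′ :+ b) := s :+ s′ :+ a :+ b) refl s s′ a b ⟩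
  s + s′ + a + b       ∎)
  where
  open ≡-Reasoning
  open +-*-Solver

flow-⊕ : {O O′ : Matrix m} {a b c : Fin m} → Flow O a b → Flow O′ b c → Flow (O ⊕ O′) a c
flow-⊕ {O = O} {O′} {a} {b} {c} (flow f) (flow f′) = flow λ x → begin
  rowSum (O ⊕ O′) x + δ x c          ≡⟨ cong (_+ δ x c) (rowSum-⊕ O O′ x) ⟩
  rowSum O x + rowSum O′ x + δ x c   ≡⟨ telescope _ _ (colSum O x) (colSum O′ x) (δ x a) (δ x b) _ (f x) (f′ x) ⟩
  colSum O x + colSum O′ x + δ x a   ≡⟨ cong (_+ δ x a) (sym (colSum-⊕ O O′ x)) ⟩
  colSum (O ⊕ O′) x + δ x a          ∎
  where open ≡-Reasoning

flow-cancel : {O : Matrix m} {a b : Fin m} → Circulation (O ⊕ arc a b) → Flow O b a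
flow-cancel {O = O} {a} {b} (circulation c) = flow λ x → begin
  rowSum O x + δ x a              ≡⟨ cong (rowSum O x +_) (sym (rowSum-arc a b x)) ⟩
  rowSum O x + rowSum (arc a b) x ≡⟨ sym (rowSum-⊕ O (arc a b) x) ⟩
  rowSum (O ⊕ arc a b) x          ≡⟨ c x ⟩
  colSum (O ⊕ arc a b) x          ≡⟨ colSum-⊕ O (arc a b) x ⟩
  colSum O x + colSum (arc a b) x ≡⟨ cong (colSum O x +_) (colSum-arc a b x) ⟩
  colSum O x + δ x b              ∎
  where open ≡-Reasoning

balanced-cong : {W W′ : Matrix m} → W ≐ W′ → BalancedOrientation W → BalancedOrientation W′
balanced-cong W≐W′ (O , o , c) = O , orients-cong ≐-refl W≐W′ o , c

rowSum-⊕-link : (M : Matrix m) (a b x : Fin m) → rowSum (M ⊕ link a b) x ≡ rowSum M x + (δ x a + δ x b)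
rowSum-⊕-link M a b x = trans (rowSum-⊕ M (link a b) x) (cong (rowSum M x +_) (rowSum-link a b x))

-- a splitting-off step: W′ has fewer edges, and balanced orientations of W′ lift to W
record Reduction (W : Matrix m) : Set where
  field
    W′           : Matrix m
    W′-symmetric : Symmetric W′
    W′-loopless  : Loopless W′
    loss         : Fin m → ℕ
    degrees      : ∀ x → rowSum W x ≡ rowSum W′ x + (loss x + loss x)
    progress     : 0 < sum loss
    lift         : BalancedOrientation W′ → BalancedOrientation W

reduce-digon : {W W₀ : Matrix m} {u v : Fin m} → Symmetric W₀ → Loopless W₀ →
               W ≐ W₀ ⊕ link v u ⊕ link v u → Reduction W
reduce-digon {W = W} {W₀} {u} {v} sym₀ loop₀ W≐ = record
  { W′           = W₀
  ; W′-symmetric = sym₀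
  ; W′-loopless  = loop₀
  ; loss         = λ x → δ x v + δ x u
  ; degrees      = degrees
  ; progress     = subst (0 <_)
                     (sym (trans (∑-distrib-+ (λ x → δ x v) (λ x → δ x u)) (cong₂ _+_ (sum-δ v) (sum-δ u))))
                     (s≤s z≤n)
  ; lift         = lift
  }
  where
  degrees : ∀ x → rowSum W x ≡ rowSum W₀ x + ((δ x v + δ x u) + (δ x v + δ x u))
  degrees x = begin
    rowSum W x                                                 ≡⟨ rowSum-cong W≐ x ⟩
    rowSum (W₀ ⊕ link v u ⊕ link v u) x                        ≡⟨ rowSum-⊕-link (W₀ ⊕ link v u) v u x ⟩
    rowSum (W₀ ⊕ link v u) x + (δ x v + δ x u)                 ≡⟨ cong (_+ (δ x v + δ x u)) (rowSum-⊕-link W₀ v u x) ⟩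
    rowSum W₀ x + (δ x v + δ x u) + (δ x v + δ x u)            ≡⟨ +-assoc (rowSum W₀ x) _ _ ⟩
    rowSum W₀ x + ((δ x v + δ x u) + (δ x v + δ x u))          ∎
    where open ≡-Reasoning
  lift : BalancedOrientation W₀ → BalancedOrientation W
  lift (O , o , c) =
    O ⊕ arc v u ⊕ arc u v ,
    orients-cong ≐-refl
      (pointwise λ x y → trans (cong (W₀ x y + link v u x y +_) (+-comm (arc u v x y) _)) (sym (_≐_.≐-at W≐ x y)))
      (orients-⊕ (orients-⊕ o (arc-orients v u)) (arc-orients u v)) ,
    flow⇒circulation (flow-⊕ (flow-⊕ (circulation⇒flow c v) (arc-flow v u)) (arc-flow u v))

-- an arc u → w of a balanced orientation of W₀ + (u — w) is replaced by the path u → v → w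
reroute : {O W₀ : Matrix m} {u v w : Fin m} → Orients O (W₀ ⊕ link u w) → Circulation O → 1 ≤ O u w →
          BalancedOrientation (W₀ ⊕ link u v ⊕ link v w)
reroute {O = O} {W₀} {u} {v} {w} o c Ouw≥1 =
  O₀ ⊕ arc u v ⊕ arc v w ,
  orients-⊕ (orients-⊕ o₀ (arc-orients u v)) (arc-orients v w) ,
  flow⇒circulation (flow-⊕ (flow-⊕ f₀ (arc-flow u v)) (arc-flow v w))
  where
  O₀ = O ⊖ arc u w
  split : O₀ ⊕ arc u w ≐ O
  split = ⊖-⊕ (arc-≤ Ouw≥1)
  o₀ : Orients O₀ W₀
  o₀ = orients-cancel (orients-cong (≐-sym split) ≐-refl o) (arc-orients u w)
  f₀ : Flow O₀ w u
  f₀ = flow-cancel (circulation-cong (≐-sym split) c)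

reduce-path : {W W₀ : Matrix m} {u v w : Fin m} → Symmetric W₀ → Loopless W₀ → u ≢ w →
              W ≐ W₀ ⊕ link v w ⊕ link v u → Reduction W
reduce-path {W = W} {W₀} {u} {v} {w} sym₀ loop₀ u≢w W≐ = record
  { W′           = W₀ ⊕ link u w
  ; W′-symmetric = ⊕-symmetric sym₀ (link-symmetric u w)
  ; W′-loopless  = ⊕-loopless {M = W₀} {N = link u w} loop₀ (link-loopless u≢w)
  ; loss         = λ x → δ x v
  ; degrees      = degrees
  ; progress     = subst (0 <_) (sym (sum-δ v)) (s≤s z≤n)
  ; lift         = lift
  }
  where
  open +-*-Solver
  degrees : ∀ x → rowSum W x ≡ rowSum (W₀ ⊕ link u w) x + (δ x v + δ x v)
  degrees x = begin
    rowSum W x                                              ≡⟨ rowSum-cong W≐ x ⟩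
    rowSum (W₀ ⊕ link v w ⊕ link v u) x                     ≡⟨ rowSum-⊕-link (W₀ ⊕ link v w) v u x ⟩
    rowSum (W₀ ⊕ link v w) x + (δ x v + δ x u)              ≡⟨ cong (_+ (δ x v + δ x u)) (rowSum-⊕-link W₀ v w x) ⟩
    rowSum W₀ x + (δ x v + δ x w) + (δ x v + δ x u)         ≡⟨ solve 4 (λ r a b c → r :+ (a :+ b) :+ (a :+ c) := r :+ (c :+ b) :+ (a :+ a))
                                                                         refl (rowSum W₀ x) (δ x v) (δ x w) (δ x u) ⟩
    rowSum W₀ x + (δ x u + δ x w) + (δ x v + δ x v)         ≡⟨ cong (_+ (δ x v + δ x v)) (sym (rowSum-⊕-link W₀ u w x)) ⟩
    rowSum (W₀ ⊕ link u w) x + (δ x v + δ x v)              ∎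
    where open ≡-Reasoning
  path-uvw : W₀ ⊕ link u v ⊕ link v w ≐ W
  path-uvw = pointwise λ x y → begin
    W₀ x y + link u v x y + link v w x y   ≡⟨ xy∙z≈xz∙y (W₀ x y) _ _ ⟩
    W₀ x y + link v w x y + link u v x y   ≡⟨ cong (W₀ x y + link v w x y +_) (+-comm (arc u v x y) _) ⟩
    W₀ x y + link v w x y + link v u x y   ≡⟨ sym (_≐_.≐-at W≐ x y) ⟩
    W x y                                  ∎
    where open ≡-Reasoning
  path-wvu : W₀ ⊕ link w v ⊕ link v u ≐ W
  path-wvu = pointwise λ x y →
    trans (cong (λ l → W₀ x y + l + link v u x y) (+-comm (arc w v x y) _)) (sym (_≐_.≐-at W≐ x y))
  lift : BalancedOrientation (W₀ ⊕ link u w) → BalancedOrientation W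
  lift (O , o , c) with 1 ≤? O u w
  ... | yes Ouw≥1 = balanced-cong path-uvw (reroute {W₀ = W₀} {v = v} o c Ouw≥1)
  ... | no Ouw≱1  = balanced-cong path-wvu (reroute {W₀ = W₀} {v = v} o′ c Owu≥1)
    where
    o′ : Orients O (W₀ ⊕ link w u)
    o′ = orients-cong ≐-refl (pointwise λ x y → cong (W₀ x y +_) (+-comm (arc u w x y) _)) o
    Ouw+Owu≥1 : 1 ≤ O u w + O w u
    Ouw+Owu≥1 = subst (1 ≤_) (sym (Orients.orients-at o u w))
                  (≤-trans (≤-reflexive (sym (arc-on u w))) (≤-trans (m≤m+n _ (arc w u u w)) (m≤n+m _ (W₀ u w))))
    Owu≥1 : 1 ≤ O w u
    Owu≥1 = subst (λ a → 1 ≤ a + O w u) (n≤0⇒n≡0 (≮⇒≥ Ouw≱1)) Ouw+Owu≥1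

EvenDegrees : Matrix m → Set
EvenDegrees W = ∀ x → Even (rowSum W x)

loopless-≢ : {M : Matrix m} {a b : Fin m} → Loopless M → 1 ≤ M a b → a ≢ b
loopless-≢ {a = a} (loopless M-loop) Mab≥1 refl = <⇒≱ Mab≥1 (≤-reflexive (M-loop a))

split-twice : {W W₁ W₀ A B : Matrix m} → W₀ ⊕ A ≐ W₁ → W₁ ⊕ B ≐ W → W ≐ W₀ ⊕ A ⊕ B
split-twice {B = B} (pointwise split₀) (pointwise split₁) =
  pointwise λ x y → trans (sym (split₁ x y)) (cong (_+ B x y) (sym (split₀ x y)))

-- split off an edge v — u together with a second edge v — w, which exists because the degree of v is even
reduce-at : {W : Matrix m} {u v : Fin m} → Symmetric W → Loopless W → EvenDegrees W → 1 ≤ W v u → Reduction W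
reduce-at {W = W} {u} {v} W-sym W-loop W-even Wvu≥1 =
  second-edge (sum>0⇒∃>0 (W₁ v) (even-suc⇒pos (subst Even deg-v (W-even v))))
  where
  v≢u = loopless-≢ W-loop Wvu≥1
  W₁ = W ⊖ link v u
  sym₁ : Symmetric W₁
  sym₁ = ⊖-symmetric W-sym (link-symmetric v u)
  loop₁ : Loopless W₁
  loop₁ = ⊖-loopless (link v u) W-loop
  split₁ : W₁ ⊕ link v u ≐ W
  split₁ = ⊖-⊕ (link-≤ W-sym v≢u Wvu≥1)
  deg-v : rowSum W v ≡ suc (rowSum W₁ v)
  deg-v = begin
    rowSum W v                        ≡⟨ sym (rowSum-cong split₁ v) ⟩
    rowSum (W₁ ⊕ link v u) v          ≡⟨ rowSum-⊕-link W₁ v u v ⟩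
    rowSum W₁ v + (δ v v + δ v u)     ≡⟨ cong₂ (λ a b → rowSum W₁ v + (a + b)) (δ-refl v) (δ-≢ v≢u) ⟩
    rowSum W₁ v + 1                   ≡⟨ +-comm _ 1 ⟩
    suc (rowSum W₁ v)                 ∎
    where open ≡-Reasoning
  second-edge : (∃ λ w → 1 ≤ W₁ v w) → Reduction W
  second-edge (w , W₁vw≥1) with w ≟ u
  ... | yes refl =
    reduce-digon {W₀ = W₁ ⊖ link v u} {u} {v}
      (⊖-symmetric sym₁ (link-symmetric v u)) (⊖-loopless (link v u) loop₁)
      (split-twice {W₀ = W₁ ⊖ link v u} {A = link v u} (⊖-⊕ (link-≤ sym₁ v≢u W₁vw≥1)) split₁)
  ... | no w≢u =
    reduce-path {W₀ = W₁ ⊖ link v w} {u} {v} {w}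
      (⊖-symmetric sym₁ (link-symmetric v w)) (⊖-loopless (link v w) loop₁) (w≢u ∘ sym)
      (split-twice {W₀ = W₁ ⊖ link v w} {A = link v w} (⊖-⊕ (link-≤ sym₁ (loopless-≢ loop₁ W₁vw≥1) W₁vw≥1)) split₁)

total-reduction : {W : Matrix m} (R : Reduction W) → total (Reduction.W′ R) < total W
total-reduction {W = W} R = subst (total W′ <_) (sym total-W) (m<m+n (total W′) (≤-trans progress (m≤m+n _ _)))
  where
  open Reduction R
  total-W : total W ≡ total W′ + (sum loss + sum loss)
  total-W = begin
    total W                                         ≡⟨ sum-cong-≗ degrees ⟩
    sum (λ x → rowSum W′ x + (loss x + loss x))     ≡⟨ ∑-distrib-+ (rowSum W′) _ ⟩
    total W′ + sum (λ x → loss x + loss x)          ≡⟨ cong (total W′ +_) (∑-distrib-+ loss loss) ⟩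
    total W′ + (sum loss + sum loss)                ∎
    where open ≡-Reasoning

opaque
  balanced-orientation : {W : Matrix m} → Symmetric W → Loopless W → EvenDegrees W → BalancedOrientation W
  balanced-orientation {W = W} = orient (suc (total W)) ≤-refl
    where
    orient : ∀ fuel {W : Matrix m} → total W < fuel → Symmetric W → Loopless W → EvenDegrees W → BalancedOrientation W
    orient zero    ()
    orient (suc fuel) {W} total<fuel W-sym W-loop W-even with any? (λ v → 0 <? rowSum W v)
    ... | no all-zero = (λ _ _ → 0) , orients (λ x y → sym (sum≡0⇒≡0 (W x) (deg0 x) y)) , circulation (λ _ → refl)
      where
      deg0 : ∀ x → rowSum W x ≡ 0
      deg0 x = n≤0⇒n≡0 (≮⇒≥ (λ pos → all-zero (x , pos)))
    ... | yes (v , pos) with u , Wvu≥1 ← sum>0⇒∃>0 (W v) pos = lift (orient fuel smaller W′-symmetric W′-loopless even)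
      where
      R : Reduction W
      R = reduce-at W-sym W-loop W-even Wvu≥1
      open Reduction R
      smaller : total W′ < fuel
      smaller = <-≤-trans (total-reduction R) (≤-pred total<fuel)
      even : EvenDegrees W′
      even x = even-+-double⁻ (rowSum W′ x) (loss x) (subst Even (degrees x) (W-even x))

degree-halves : {O W : Matrix m} → Orients O W → Circulation O → ∀ x → rowSum O x + rowSum O x ≡ rowSum W x
degree-halves {O = O} (orients o) (circulation c) x =
  trans (cong (rowSum O x +_) (c x)) (trans (sym (∑-distrib-+ (O x) (λ y → O y x))) (sum-cong-≗ (o x)))

orients⇒≤ : {O W : Matrix m} → Orients O W → ∀ x y → O x y ≤ W x y
orients⇒≤ {O = O} (orients o) x y = subst (O x y ≤_) (o x y) (m≤m+n (O x y) (O y x))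

half : ∀ {a b} → a + a ≡ b + b → a ≡ b
half {a} {b} e = trans (n≡⌊n+n/2⌋ a) (trans (cong ⌊_/2⌋ e) (sym (n≡⌊n+n/2⌋ b)))

-- Regular bipartite multigraphs, given by their biadjacency matrices

record Regular (d : ℕ) (Z : Matrix m) : Set where
  constructor regular
  field
    rows : ∀ r → rowSum Z r ≡ d
    cols : ∀ c → colSum Z c ≡ d

sum-↑ : ∀ m {n} (f : Fin (m + n) → ℕ) → sum f ≡ sum (f ∘ (_↑ˡ n)) + sum (f ∘ (m ↑ʳ_))
sum-↑ zero    f = refl
sum-↑ (suc m) f = trans (cong (f zero +_) (sum-↑ m (f ∘ suc))) (sym (+-assoc (f zero) _ _))

between : Matrix m → Fin m ⊎ Fin m → Fin m ⊎ Fin m → ℕ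
between Z (inj₁ r) (inj₂ c) = Z r c
between Z (inj₂ c) (inj₁ r) = Z r c
between Z (inj₁ _) (inj₁ _) = 0
between Z (inj₂ _) (inj₂ _) = 0

-- the bipartite multigraph on rows ⊎ columns, with vertex set Fin (m + m)
bipartite : Matrix m → Matrix (m + m)
bipartite {m} Z x y = between Z (splitAt m x) (splitAt m y)

module _ {n : ℕ} (Z : Matrix n) where

  private
    L R : Fin n → Fin (n + n)
    L r = r ↑ˡ n
    R c = n ↑ʳ c

  sum-halves : (f : Fin n ⊎ Fin n → ℕ) → sum (f ∘ splitAt n) ≡ sum (f ∘ inj₁) + sum (f ∘ inj₂)
  sum-halves f = trans (sum-↑ n (f ∘ splitAt n))
    (cong₂ _+_ (sum-cong-≗ (λ r → cong f (splitAt-↑ˡ n r n))) (sum-cong-≗ (λ c → cong f (splitAt-↑ʳ n n c))))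

  bipartite-symmetric : Symmetric (bipartite Z)
  bipartite-symmetric = symmetric λ x y → between-sym (splitAt n x) (splitAt n y)
    where
    between-sym : ∀ p q → between Z p q ≡ between Z q p
    between-sym (inj₁ _) (inj₁ _) = refl
    between-sym (inj₁ _) (inj₂ _) = refl
    between-sym (inj₂ _) (inj₁ _) = refl
    between-sym (inj₂ _) (inj₂ _) = refl

  bipartite-loopless : Loopless (bipartite Z)
  bipartite-loopless = loopless λ x → between-diag (splitAt n x)
    where
    between-diag : ∀ p → between Z p p ≡ 0
    between-diag (inj₁ _) = refl
    between-diag (inj₂ _) = refl

  bipartite-regular : ∀ {d} → Regular d Z → ∀ x → rowSum (bipartite Z) x ≡ d
  bipartite-regular {d} (regular rows cols) x = trans (sum-halves (between Z (splitAt n x))) (row (splitAt n x))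
    where
    row : ∀ p → sum (between Z p ∘ inj₁) + sum (between Z p ∘ inj₂) ≡ d
    row (inj₁ r) = trans (cong (_+ rowSum Z r) (sum-replicate-zero n)) (rows r)
    row (inj₂ c) = trans (cong (colSum Z c +_) (sum-replicate-zero n)) (trans (+-identityʳ _) (cols c))

  -- the arcs row → column and column → row of a balanced orientation of the bipartite multigraph
  euler-split : ∀ {h} → Regular (h + h) Z → ∃ λ Z₁ → ∃ λ Z₂ → Z₁ ⊕ Z₂ ≐ Z × Regular h Z₁ × Regular h Z₂
  euler-split {h} Z-regular = Z₁ , Z₂ , pointwise Z₁+Z₂ , Z₁-regular , Z₂-regular
    where
    B = bipartite Z
    orientation : BalancedOrientation B
    orientation = balanced-orientation bipartite-symmetric bipartite-loopless
                    (λ x → subst Even (sym (bipartite-regular Z-regular x)) (even-+-double⁺ even0 h))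
    O = proj₁ orientation
    O-orients = proj₁ (proj₂ orientation)
    O-circulation = proj₂ (proj₂ orientation)
    out-h : ∀ x → rowSum O x ≡ h
    out-h x = half (trans (degree-halves O-orients O-circulation x) (bipartite-regular Z-regular x))
    in-h : ∀ x → colSum O x ≡ h
    in-h x = trans (sym (Circulation.circulation-at O-circulation x)) (out-h x)
    B-LR : ∀ r c → B (L r) (R c) ≡ Z r c
    B-LR r c = cong₂ (between Z) (splitAt-↑ˡ n r n) (splitAt-↑ʳ n n c)
    B-LL : ∀ r r′ → B (L r) (L r′) ≡ 0
    B-LL r r′ = cong₂ (between Z) (splitAt-↑ˡ n r n) (splitAt-↑ˡ n r′ n)
    B-RR : ∀ c c′ → B (R c) (R c′) ≡ 0
    B-RR c c′ = cong₂ (between Z) (splitAt-↑ʳ n n c) (splitAt-↑ʳ n n c′)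
    O-zero : ∀ {x y} → B x y ≡ 0 → O x y ≡ 0
    O-zero {x} {y} B≡0 = n≤0⇒n≡0 (subst (O x y ≤_) B≡0 (orients⇒≤ O-orients x y))
    drop-left : (f : Fin (n + n) → ℕ) → (∀ r → f (L r) ≡ 0) → sum f ≡ sum (f ∘ R)
    drop-left f left≡0 = trans (sum-↑ n f) (cong (_+ sum (f ∘ R)) (trans (sum-cong-≗ left≡0) (sum-replicate-zero n)))
    drop-right : (f : Fin (n + n) → ℕ) → (∀ c → f (R c) ≡ 0) → sum f ≡ sum (f ∘ L)
    drop-right f right≡0 =
      trans (sum-↑ n f)
        (trans (cong (sum (f ∘ L) +_) (trans (sum-cong-≗ right≡0) (sum-replicate-zero n))) (+-identityʳ _))
    Z₁ Z₂ : Matrix n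
    Z₁ r c = O (L r) (R c)
    Z₂ r c = O (R c) (L r)
    Z₁+Z₂ : ∀ r c → Z₁ r c + Z₂ r c ≡ Z r c
    Z₁+Z₂ r c = trans (Orients.orients-at O-orients (L r) (R c)) (B-LR r c)
    Z₁-regular : Regular h Z₁
    Z₁-regular = regular
      (λ r → trans (sym (drop-left (O (L r)) (λ r′ → O-zero (B-LL r r′)))) (out-h (L r)))
      (λ c → trans (sym (drop-right (λ x → O x (R c)) (λ c′ → O-zero (B-RR c′ c)))) (in-h (R c)))
    Z₂-regular : Regular h Z₂
    Z₂-regular = regular
      (λ r → trans (sym (drop-left (λ x → O x (L r)) (λ r′ → O-zero (B-LL r′ r)))) (in-h (L r)))
      (λ c → trans (sym (drop-right (O (R c)) (λ c′ → O-zero (B-RR c c′)))) (out-h (R c)))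

-- Perfect matchings in regular bipartite multigraphs, by Alon's repeated Euler splitting

record Refinement (z₁ z₂ x y : ℕ) : Set where
  constructor refinement
  field
    x₁ y₁ x₂ y₂ : ℕ
    z₁≡ : x₁ + y₁ ≡ z₁
    z₂≡ : x₂ + y₂ ≡ z₂
    x≡  : x₁ + x₂ ≡ x
    y≡  : y₁ + y₂ ≡ y

refine : ∀ z₁ z₂ x y → z₁ + z₂ ≡ x + y → Refinement z₁ z₂ x y
refine zero     z₂ x       y e = refinement 0 0 x y refl (sym e) refl refl
refine (suc z₁) z₂ zero    y e = refinement 0 (suc z₁) 0 z₂ refl refl refl e
refine (suc z₁) z₂ (suc x) y e with refinement x₁ y₁ x₂ y₂ p q r s ← refine z₁ z₂ x y (suc-injective e) =
  refinement (suc x₁) y₁ x₂ y₂ (cong suc p) q (cong suc r) s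

regular-cong : {M M′ : Matrix m} {d : ℕ} → M ≐ M′ → Regular d M → Regular d M′
regular-cong M≐M′ (regular rows cols) =
  regular (λ r → trans (sym (rowSum-cong M≐M′ r)) (rows r)) (λ c → trans (sym (colSum-cong M≐M′ c)) (cols c))

total-⊕ : (M N : Matrix m) → total (M ⊕ N) ≡ total M + total N
total-⊕ M N = trans (sum-cong-≗ (rowSum-⊕ M N)) (∑-distrib-+ (rowSum M) (rowSum N))

total-cong : {M N : Matrix m} → M ≐ N → total M ≡ total N
total-cong M≐N = sum-cong-≗ (rowSum-cong M≐N)

n<2^n : ∀ n → n < 2 ^ n
n<2^n zero    = s≤s z≤n
n<2^n (suc n) = subst (_≤ 2 ^ suc n) (+-comm (suc n) 1) (+-mono-≤ (n<2^n n) (≤-trans (m^n>0 2 n) (m≤m+n _ 0)))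

record Approximation (N : Matrix m) (d : ℕ) : Set where
  field
    X Y         : Matrix m
    X⊕Y-regular : Regular (2 ^ d) (X ⊕ Y)
    support     : ∀ r c → 1 ≤ X r c → 1 ≤ N r c
    small       : total Y < 2 ^ d

smaller-half : ∀ {a b h} → a ≤ b → a + b < h + h → a < h
smaller-half {a} {b} {h} a≤b a+b<2h = ≰⇒> λ h≤a → <⇒≱ a+b<2h (+-mono-≤ h≤a (≤-trans h≤a a≤b))

-- split X ⊕ Y into two 2^d-regular halves and keep the one with fewer edges from Y
halve : {N : Matrix m} {d : ℕ} → Approximation N (suc d) → Approximation N d
halve {m} {N} {d} A = choose (≤-total (total Y₁) (total Y₂))
  where
  open Approximation A
  open Refinement
  h = 2 ^ d
  split = euler-split (X ⊕ Y) (subst (λ e → Regular e (X ⊕ Y)) (cong (h +_) (+-identityʳ h)) X⊕Y-regular)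
  Z₁ = proj₁ split
  Z₂ = proj₁ (proj₂ split)
  Z₁-regular = proj₁ (proj₂ (proj₂ (proj₂ split)))
  Z₂-regular = proj₂ (proj₂ (proj₂ (proj₂ split)))
  at : ∀ r c → Refinement (Z₁ r c) (Z₂ r c) (X r c) (Y r c)
  at r c = refine _ _ _ _ (_≐_.≐-at (proj₁ (proj₂ (proj₂ split))) r c)
  X₁ Y₁ X₂ Y₂ : Matrix m
  X₁ r c = x₁ (at r c)
  Y₁ r c = y₁ (at r c)
  X₂ r c = x₂ (at r c)
  Y₂ r c = y₂ (at r c)
  Y₁+Y₂<2h : total Y₁ + total Y₂ < h + h
  Y₁+Y₂<2h = subst₂ _<_ (trans (total-cong (pointwise λ r c → sym (y≡ (at r c)))) (total-⊕ Y₁ Y₂))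
                        (cong (h +_) (+-identityʳ h)) small
  keep : (X′ Y′ Z′ : Matrix m) → (∀ r c → X′ r c + Y′ r c ≡ Z′ r c) → Regular h Z′ →
         (∀ r c → X′ r c ≤ X r c) → total Y′ < h → Approximation N d
  keep X′ Y′ Z′ X′+Y′ Z′-regular X′≤X Y′-small = record
    { X           = X′
    ; Y           = Y′
    ; X⊕Y-regular = regular-cong (≐-sym (pointwise X′+Y′)) Z′-regular
    ; support     = λ r c p → support r c (≤-trans p (X′≤X r c))
    ; small       = Y′-small
    }
  choose : total Y₁ ≤ total Y₂ ⊎ total Y₂ ≤ total Y₁ → Approximation N d
  choose (inj₁ Y₁≤Y₂) = keep X₁ Y₁ Z₁ (λ r c → z₁≡ (at r c)) Z₁-regular
                          (λ r c → subst (X₁ r c ≤_) (x≡ (at r c)) (m≤m+n _ _))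
                          (smaller-half Y₁≤Y₂ Y₁+Y₂<2h)
  choose (inj₂ Y₂≤Y₁) = keep X₂ Y₂ Z₂ (λ r c → z₂≡ (at r c)) Z₂-regular
                          (λ r c → subst (X₂ r c ≤_) (x≡ (at r c)) (m≤n+m _ _))
                          (smaller-half Y₂≤Y₁ (subst (_< h + h) (+-comm (total Y₁) _) Y₁+Y₂<2h))

infixr 7 _·_

_·_ : ℕ → Matrix m → Matrix m
(α · M) x y = α * M x y

rowSum-· : (α : ℕ) (M : Matrix m) (r : Fin m) → rowSum (α · M) r ≡ α * rowSum M r
rowSum-· α M r = sym (*-distribˡ-sum α (M r))

colSum-· : (α : ℕ) (M : Matrix m) (c : Fin m) → colSum (α · M) c ≡ α * colSum M c
colSum-· α M c = sym (*-distribˡ-sum α (λ r → M r c))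

rowSum-δ : (r : Fin m) → rowSum δ r ≡ 1
rowSum-δ r = trans (sum-cong-≗ (δ-sym r)) (sum-δ r)

colSum-δ : (c : Fin m) → colSum δ c ≡ 1
colSum-δ = sum-δ

scaled-support : ∀ α x → 1 ≤ α * x → 1 ≤ x
scaled-support α zero    αx≥1 = ⊥-elim (<⇒≱ αx≥1 (≤-reflexive (*-zeroʳ α)))
scaled-support α (suc x) _    = s≤s z≤n

-- with t = k m and 2^t = α k + β, β < k: the multigraph α N ⊕ β δ is 2^t-regular and β δ has m β < 2^t edges
approximation₀ : ∀ {k} .{{_ : NonZero k}} {N : Matrix m} → Regular k N → Approximation N (k * m)
approximation₀ {m} {k} {N} (regular rows cols) = record
  { X           = α · N
  ; Y           = β · δ
  ; X⊕Y-regular = regular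
      (λ r → row-or-column (rowSum-⊕ (α · N) (β · δ) r) (rowSum-· α N r) (rows r) (rowSum-· β δ r) (rowSum-δ r))
      (λ c → row-or-column (colSum-⊕ (α · N) (β · δ) c) (colSum-· α N c) (cols c) (colSum-· β δ c) (colSum-δ c))
  ; support     = λ r c → scaled-support α (N r c)
  ; small       = ≤-<-trans total-Y (n<2^n t)
  }
  where
  t = k * m
  α = 2 ^ t / k
  β = 2 ^ t % k
  row-or-column : ∀ {s sX sY sN sδ} → s ≡ sX + sY → sX ≡ α * sN → sN ≡ k → sY ≡ β * sδ → sδ ≡ 1 → s ≡ 2 ^ t
  row-or-column refl refl refl refl refl = begin
    α * k + β * 1  ≡⟨ cong (α * k +_) (*-identityʳ β) ⟩
    α * k + β      ≡⟨ +-comm (α * k) β ⟩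
    β + α * k      ≡⟨ sym (m≡m%n+[m/n]*n (2 ^ t) k) ⟩
    2 ^ t          ∎
    where open ≡-Reasoning
  total-Y : total (β · δ {m}) ≤ t
  total-Y = begin
    total (β · δ {m})   ≡⟨ sum-cong-≗ {m} (λ r → trans (rowSum-· β δ r) (trans (cong (β *_) (rowSum-δ r)) (*-identityʳ β))) ⟩
    sum {m} (λ _ → β)   ≡⟨ sum-const m β ⟩
    m * β               ≤⟨ *-monoʳ-≤ m (<⇒≤ (m%n<n (2 ^ t) k)) ⟩
    m * k               ≡⟨ *-comm m k ⟩
    t                   ∎
    where open ≤-Reasoning

PerfectMatching : Matrix m → Set
PerfectMatching N = ∃ λ σ → Injective _≡_ _≡_ σ × ∀ r → 1 ≤ N r (σ r)

halve-iterated : {N : Matrix m} → ∀ d → Approximation N d → Approximation N 0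
halve-iterated zero    A = A
halve-iterated (suc d) A = halve-iterated d (halve A)

regular₁⇒matching : {X : Matrix m} → Regular 1 X → PerfectMatching X
regular₁⇒matching {X = X} (regular rows cols) = σ , injective , λ r → proj₂ (entry r)
  where
  entry : ∀ r → ∃ λ c → 1 ≤ X r c
  entry r = sum>0⇒∃>0 (X r) (≤-reflexive (sym (rows r)))
  σ = λ r → proj₁ (entry r)
  injective : Injective _≡_ _≡_ σ
  injective {a} {b} σa≡σb with a ≟ b
  ... | yes a≡b = a≡b
  ... | no a≢b  = ⊥-elim (<⇒≱ (≤-trans two-entries (terms≤sum (λ r → X r (σ a)) a≢b)) (≤-reflexive (cols (σ a))))
    where
    two-entries : 2 ≤ X a (σ a) + X b (σ a)
    two-entries = +-mono-≤ (proj₂ (entry a)) (subst (λ c → 1 ≤ X b c) (sym σa≡σb) (proj₂ (entry b)))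

approximation⇒matching : {N : Matrix m} → Approximation N 0 → PerfectMatching N
approximation⇒matching {N = N} A = σ , injective , λ r → support r (σ r) (hit r)
  where
  open Approximation A
  Y≡0 : ∀ r c → Y r c ≡ 0
  Y≡0 r c = sum≡0⇒≡0 (Y r) (sum≡0⇒≡0 (rowSum Y) (n≤0⇒n≡0 (≤-pred small)) r) c
  X⊕Y≐X : X ⊕ Y ≐ X
  X⊕Y≐X = pointwise λ r c → trans (cong (X r c +_) (Y≡0 r c)) (+-identityʳ _)
  matching = regular₁⇒matching (regular-cong X⊕Y≐X X⊕Y-regular)
  σ = proj₁ matching
  injective = proj₁ (proj₂ matching)
  hit = proj₂ (proj₂ matching)

opaque
  perfect-matching : ∀ {k} .{{_ : NonZero k}} {N : Matrix m} → Regular k N → PerfectMatching N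
  perfect-matching {m} {k} N-regular = approximation⇒matching (halve-iterated (k * m) (approximation₀ N-regular))

-- Orbits of a permutation

minimal : {P : ℕ → Set} → Decidable P → ∀ w → P w → ∃ λ p → P p × (∀ {i} → i < p → ¬ P i)
minimal {P} P? = <-rec (λ w → P w → ∃ λ p → P p × (∀ {i} → i < p → ¬ P i)) step
  where
  step : ∀ w → (∀ {i} → i < w → P i → ∃ λ p → P p × (∀ {j} → j < p → ¬ P j)) →
         P w → ∃ λ p → P p × (∀ {i} → i < p → ¬ P i)
  step w smaller Pw with anyUpTo? P? w
  ... | yes (i , i<w , Pi) = smaller i<w Pi
  ... | no none            = w , Pw , λ i<w Pi → none (_ , i<w , Pi)

module _ {A : Set} (f : A → A) where

  iterate-commute : ∀ x i → f (iterate f x i) ≡ iterate f (f x) i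
  iterate-commute x zero    = refl
  iterate-commute x (suc i) = iterate-commute (f x) i

  iterate-+ : ∀ x i j → iterate f x (i + j) ≡ iterate f (iterate f x i) j
  iterate-+ x zero    j = refl
  iterate-+ x (suc i) j = iterate-+ (f x) i j

  module _ (f-injective : Injective _≡_ _≡_ f) where

    iterate-injective : ∀ {x y} i → iterate f x i ≡ iterate f y i → x ≡ y
    iterate-injective zero    e = e
    iterate-injective (suc i) e = f-injective (iterate-injective i e)

    iterate-return : ∀ x i d → iterate f x i ≡ iterate f x (i + d) → iterate f x d ≡ x
    iterate-return x i d e = sym (iterate-injective i (trans e (trans (cong (iterate f x) (+-comm i d)) (iterate-+ x d i))))

module Orbit {n : ℕ} (σ : Fin n → Fin n) (σ-injective : Injective _≡_ _≡_ σ) (v : Fin n) where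

  Returns : ℕ → Set
  Returns i = 1 ≤ i × iterate σ v i ≡ v

  returns? : Decidable Returns
  returns? i = 1 ≤? i ×-dec iterate σ v i ≟ v

  -- by the pigeonhole principle two of the points σ⁰ v, …, σⁿ v coincide
  eventually-returns : ∃ Returns
  eventually-returns with i , j , i<j , σⁱ≡σʲ ← pigeonhole (n<1+n n) (λ (i : Fin (suc n)) → iterate σ v (toℕ i)) =
    toℕ j ∸ toℕ i , m<n⇒0<n∸m i<j ,
    iterate-return σ σ-injective v (toℕ i) _ (trans σⁱ≡σʲ (cong (iterate σ v) (sym (m+[n∸m]≡n (<⇒≤ i<j)))))

  opaque
    period-spec : ∃ λ p → Returns p × (∀ {i} → i < p → ¬ Returns i)
    period-spec = minimal returns? (proj₁ eventually-returns) (proj₂ eventually-returns)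

  period : ℕ
  period = proj₁ period-spec

  period≥1 : 1 ≤ period
  period≥1 = proj₁ (proj₁ (proj₂ period-spec))

  σ^period : iterate σ v period ≡ v
  σ^period = proj₂ (proj₁ (proj₂ period-spec))

  period-minimal : ∀ {i} → 1 ≤ i → i < period → iterate σ v i ≢ v
  period-minimal 1≤i i<p σⁱ≡v = proj₂ (proj₂ period-spec) i<p (1≤i , σⁱ≡v)

  period-suc : suc (pred period) ≡ period
  period-suc = suc-pred period {{>-nonZero period≥1}}

  orbit : List (Fin n)
  orbit = applyUpTo (iterate σ v) period

  orbit-unique : Unique orbit
  orbit-unique = applyUpTo⁺₁ (iterate σ v) period λ {i} {j} i<j j<p σⁱ≡σʲ →
    period-minimal (m<n⇒0<n∸m i<j) (≤-<-trans (m∸n≤m j i) j<p)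
      (iterate-return σ σ-injective v i (j ∸ i) (trans σⁱ≡σʲ (cong (iterate σ v) (sym (m+[n∸m]≡n (<⇒≤ i<j))))))

  orbit-closed : ∀ {x} → σ x ∈ orbit → x ∈ orbit
  orbit-closed {x} σx∈orbit with ∈-applyUpTo⁻ (iterate σ v) σx∈orbit
  ... | suc i , i+1<p , σx≡σⁱ⁺¹ =
    subst (_∈ orbit) (sym (σ-injective (trans σx≡σⁱ⁺¹ (sym (iterate-commute σ v i)))))
      (∈-applyUpTo⁺ (iterate σ v) (<-trans (n<1+n i) i+1<p))
  ... | zero , _ , σx≡v =
    subst (_∈ orbit) (sym (σ-injective (trans σx≡v (sym σ-last))))
      (∈-applyUpTo⁺ (iterate σ v) (subst (pred period <_) period-suc (n<1+n _)))
    where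
    σ-last : σ (iterate σ v (pred period)) ≡ v
    σ-last = trans (iterate-commute σ v (pred period)) (trans (cong (iterate σ v) period-suc) σ^period)

-- Permutations whose cycles run along edges

walk-applyUpTo : ∀ {n} {G : Graph n} (f : ℕ → Fin n) → (∀ i → Edge G (f i) (f (suc i))) →
                 ∀ q → Walk G (applyUpTo f (suc q) ++ [ f (suc q) ])
walk-applyUpTo f edge zero    = edge 0 , tt
walk-applyUpTo f edge (suc q) = edge 0 , walk-applyUpTo (f ∘ suc) (edge ∘ suc) q

record EdgePermutation {n} (G : Graph n) : Set where
  field
    σ           : Fin n → Fin n
    σ-injective : Injective _≡_ _≡_ σ
    no-2-cycles : ∀ v → σ (σ v) ≡ v → σ v ≡ v
    along-edges : ∀ v → σ v ≢ v → Edge G v (σ v)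

module _ {n} {G : Graph n} (P : EdgePermutation G) where
  open EdgePermutation P
  open import Data.List.Membership.DecPropositional (_≟_ {n}) using (_∈?_)

  iterate-moved : ∀ {v} → σ v ≢ v → ∀ i → σ (iterate σ v i) ≢ iterate σ v i
  iterate-moved {v} σv≢v i e = σv≢v (iterate-injective σ σ-injective i (trans (sym (iterate-commute σ v i)) e))

  orbit-cycle : (v : Fin n) → σ v ≢ v → Cycle G
  orbit-cycle v σv≢v = record
    { vertices = orbit
    ; long     = subst (3 ≤_) (sym (length-applyUpTo (iterate σ v) period)) period≥3
    ; distinct = orbit-unique
    ; closed   = subst (λ p → Walk G (closeUp (applyUpTo (iterate σ v) p))) period-suc
                   (subst (λ x → Walk G (applyUpTo (iterate σ v) (suc (pred period)) ++ [ x ]))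
                      (trans (cong (iterate σ v) period-suc) σ^period) (walk-applyUpTo (iterate σ v) edge (pred period)))
    }
    where
    open Orbit σ σ-injective v
    period≥3 : 3 ≤ period
    period≥3 with period | period≥1 | σ^period
    ... | suc zero             | _ | σv≡v  = ⊥-elim (σv≢v σv≡v)
    ... | suc (suc zero)       | _ | σσv≡v = ⊥-elim (σv≢v (no-2-cycles v σσv≡v))
    ... | suc (suc (suc _))    | _ | _     = s≤s (s≤s (s≤s z≤n))
    edge : ∀ i → Edge G (iterate σ v i) (iterate σ v (suc i))
    edge i = subst (Edge G (iterate σ v i)) (iterate-commute σ v i) (along-edges (iterate σ v i) (iterate-moved σv≢v i))

  fixing : List (Fin n) → Fin n → Fin n
  fixing L x with x ∈? L
  ... | yes _ = x
  ... | no _  = σ x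

  fixing-∈ : ∀ L {x} → x ∈ L → fixing L x ≡ x
  fixing-∈ L {x} x∈L with x ∈? L
  ... | yes _  = refl
  ... | no x∉L = ⊥-elim (x∉L x∈L)

  fixing-∉ : ∀ L {x} → x ∉ L → fixing L x ≡ σ x
  fixing-∉ L {x} x∉L with x ∈? L
  ... | yes x∈L = ⊥-elim (x∉L x∈L)
  ... | no _    = refl

  fixing-moved : ∀ L {x} → fixing L x ≢ x → x ∉ L
  fixing-moved L moved x∈L = moved (fixing-∈ L x∈L)

  -- L must be closed under σ⁻¹, so that σ still maps the complement of L into itself
  fix : (L : List (Fin n)) → (∀ {x} → σ x ∈ L → x ∈ L) → EdgePermutation G
  fix L closed = record
    { σ           = fixing L
    ; σ-injective = injective
    ; no-2-cycles = no-2-cycles′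
    ; along-edges = λ x moved → subst (Edge G x) (sym (fixing-∉ L (fixing-moved L moved)))
                                  (along-edges x (moved ∘ trans (fixing-∉ L (fixing-moved L moved))))
    }
    where
    injective : Injective _≡_ _≡_ (fixing L)
    injective {a} {b} e with a ∈? L | b ∈? L
    ... | yes _   | yes _   = e
    ... | yes a∈L | no b∉L  = ⊥-elim (b∉L (closed (subst (_∈ L) e a∈L)))
    ... | no a∉L  | yes b∈L = ⊥-elim (a∉L (closed (subst (_∈ L) (sym e) b∈L)))
    ... | no _    | no _    = σ-injective e
    no-2-cycles′ : ∀ x → fixing L (fixing L x) ≡ x → fixing L x ≡ x
    no-2-cycles′ x e with x ∈? L
    ... | yes _  = refl
    ... | no x∉L = no-2-cycles x (trans (sym (fixing-∉ L (x∉L ∘ closed))) e)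

record CycleCover {n} {G : Graph n} (P : EdgePermutation G) (vs : List (Fin n)) : Set where
  field
    cycles   : List (Cycle G)
    disjoint : VertexDisjoint cycles
    covers   : ∀ {v} → v ∈ vs → EdgePermutation.σ P v ≢ v → Any (λ c → v ∈ vertices c) cycles
    moved    : All (λ c → ∀ {x} → x ∈ vertices c → EdgePermutation.σ P x ≢ x) cycles

-- split off the orbit of each moved vertex in turn
cycle-cover : ∀ {n} {G : Graph n} (P : EdgePermutation G) (vs : List (Fin n)) → CycleCover P vs
cycle-cover P [] = record { cycles = [] ; disjoint = [] ; covers = λ () ; moved = [] }
cycle-cover {n} {G} P (v ∷ vs) with EdgePermutation.σ P v ≟ v
... | yes σv≡v = record
  { cycles   = cycles
  ; disjoint = disjoint
  ; covers   = λ { (here refl) σv≢v → ⊥-elim (σv≢v σv≡v) ; (there x∈vs) → covers x∈vs }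
  ; moved    = moved
  }
  where open CycleCover (cycle-cover P vs)
... | no σv≢v = record
  { cycles   = orbit-cycle P v σv≢v ∷ cycles
  ; disjoint = ++⁺ orbit-unique disjoint λ (x∈L , x∈cs) →
                 let (moved′ , x∈c) = All.lookupAny moved (concatMap⁻ vertices x∈cs)
                 in moved′ x∈c (fixing-∈ P L x∈L)
  ; covers   = covers′
  ; moved    = (λ {x} → orbit-moved {x}) ∷ All.map (λ {c} → still-moved {c}) moved
  }
  where
  open EdgePermutation P
  open Orbit σ σ-injective v
  open import Data.List.Membership.DecPropositional (_≟_ {n}) using (_∈?_)
  L = orbit
  open CycleCover (cycle-cover (fix P L orbit-closed) vs)
  orbit-moved : ∀ {x} → x ∈ L → σ x ≢ x
  orbit-moved x∈L with i , _ , refl ← ∈-applyUpTo⁻ (iterate σ v) x∈L = iterate-moved P σv≢v i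
  still-moved : ∀ {c : Cycle G} → (∀ {x} → x ∈ vertices c → fixing P L x ≢ x) → ∀ {x} → x ∈ vertices c → σ x ≢ x
  still-moved {c} moved′ {x} x∈c σx≡x = moved′ {x} x∈c (trans (fixing-∉ P L (fixing-moved P L (moved′ x∈c))) σx≡x)
  covers′ : ∀ {x} → x ∈ v ∷ vs → σ x ≢ x → Any (λ c → x ∈ vertices c) (orbit-cycle P v σv≢v ∷ cycles)
  covers′ {x} x∈v∷vs σx≢x with x ∈? L | x∈v∷vs
  ... | yes x∈L | _          = here x∈L
  ... | no x∉L  | here refl  = ⊥-elim (x∉L (∈-applyUpTo⁺ (iterate σ v) period≥1))
  ... | no x∉L  | there x∈vs = there (covers x∈vs (σx≢x ∘ trans (sym (fixing-∉ P L x∉L))))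

padding : Matrix m → ℕ → Matrix m
padding O k r c = (k ∸ rowSum O r) * δ r c

padded-regular : {O : Matrix m} {k : ℕ} → Circulation O → (∀ x → rowSum O x ≤ k) → Regular k (O ⊕ padding O k)
padded-regular {O = O} {k} (circulation c) out≤k = regular
  (λ r → begin
    rowSum (O ⊕ padding O k) r                            ≡⟨ rowSum-⊕ O (padding O k) r ⟩
    rowSum O r + sum (λ x → (k ∸ rowSum O r) * δ r x)     ≡⟨ cong (rowSum O r +_) (sum-cong-≗ (λ x → cong ((k ∸ rowSum O r) *_) (δ-sym r x))) ⟩
    rowSum O r + sum (λ x → (k ∸ rowSum O r) * δ x r)     ≡⟨ cong (rowSum O r +_) (∑-δ (λ _ → k ∸ rowSum O r) r) ⟩
    rowSum O r + (k ∸ rowSum O r)                         ≡⟨ m+[n∸m]≡n (out≤k r) ⟩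
    k                                                     ∎)
  (λ y → begin
    colSum (O ⊕ padding O k) y                            ≡⟨ colSum-⊕ O (padding O k) y ⟩
    colSum O y + sum (λ x → (k ∸ rowSum O x) * δ x y)     ≡⟨ cong₂ _+_ (sym (c y)) (∑-δ (λ x → k ∸ rowSum O x) y) ⟩
    rowSum O y + (k ∸ rowSum O y)                         ≡⟨ m+[n∸m]≡n (out≤k y) ⟩
    k                                                     ∎)
  where open ≡-Reasoning

-- Simple graphs

sum-tabulate : (f : Fin m → ℕ) → ListAction.sum (tabulate f) ≡ sum f
sum-tabulate {zero}  f = refl
sum-tabulate {suc m} f = cong (f zero +_) (sum-tabulate (f ∘ suc))

≤-foldr-⊔ : ∀ {x} xs → x ∈ xs → x ≤ foldr _⊔_ 0 xs
≤-foldr-⊔ (y ∷ ys) (here refl)  = m≤m⊔n y _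
≤-foldr-⊔ (y ∷ ys) (there x∈ys) = ≤-trans (≤-foldr-⊔ ys x∈ys) (m≤n⊔m y _)

adjacency : ∀ {n} → Graph n → Matrix n
adjacency G u v = if Adj G u v then 1 else 0

module _ {n} (G : Graph n) where

  degree≡rowSum : ∀ v → degree G v ≡ rowSum (adjacency G) v
  degree≡rowSum v = trans (cong ListAction.sum (map-tabulate id (adjacency G v))) (sum-tabulate (adjacency G v))

  degree≤maxDegree : ∀ v → degree G v ≤ maxDegree G
  degree≤maxDegree v = ≤-foldr-⊔ _ (∈-map⁺ (degree G) (∈-allFin v))

  adjacency-symmetric : Symmetric (adjacency G)
  adjacency-symmetric = symmetric λ u v → cong (λ b → if b then 1 else 0) (Graph.sym G u v)

  adjacency-loopless : Loopless (adjacency G)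
  adjacency-loopless = loopless λ v → cong (λ b → if b then 1 else 0) (irrefl G v)

  adjacency≤1 : ∀ u v → adjacency G u v ≤ 1
  adjacency≤1 u v with Adj G u v
  ... | true  = ≤-refl
  ... | false = z≤n

  adjacency⇒edge : ∀ {u v} → 1 ≤ adjacency G u v → Edge G u v
  adjacency⇒edge {u} {v} a with Adj G u v
  ... | true = refl

  edge⇒adjacency : ∀ {u v} → Edge G u v → adjacency G u v ≡ 1
  edge⇒adjacency e = cong (λ b → if b then 1 else 0) e

  -- a perfect matching of the padded orientation, read as a permutation of the vertices
  saturated-permutation : {O : Matrix n} {k : ℕ} .{{_ : NonZero k}} → Orients O (adjacency G) → Circulation O →
    (∀ x → rowSum O x ≤ k) → Σ (EdgePermutation G) λ P → ∀ v → rowSum O v ≡ k → EdgePermutation.σ P v ≢ v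
  saturated-permutation {O} {k} O-orients O-circulation out≤k = P , saturated-moved
    where
    N = O ⊕ padding O k
    matching : PerfectMatching N
    matching = perfect-matching (padded-regular O-circulation out≤k)
    σ = proj₁ matching
    σ-injective : Injective _≡_ _≡_ σ
    σ-injective = proj₁ (proj₂ matching)
    σ-in-N : ∀ v → 1 ≤ N v (σ v)
    σ-in-N = proj₂ (proj₂ matching)
    arc-of-σ : ∀ {v} → σ v ≢ v → 1 ≤ O v (σ v)
    arc-of-σ {v} σv≢v = subst (1 ≤_) N≡O (σ-in-N v)
      where
      N≡O : N v (σ v) ≡ O v (σ v)
      N≡O = trans (cong (λ d → O v (σ v) + (k ∸ rowSum O v) * d) (δ-≢ (σv≢v ∘ sym)))
                  (trans (cong (O v (σ v) +_) (*-zeroʳ (k ∸ rowSum O v))) (+-identityʳ (O v (σ v))))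
    saturated-moved : ∀ v → rowSum O v ≡ k → σ v ≢ v
    saturated-moved v out≡k σv≡v = <⇒≱ (subst (λ c → 1 ≤ N v c) σv≡v (σ-in-N v)) (≤-reflexive N-vv)
      where
      O-vv : O v v ≡ 0
      O-vv = n≤0⇒n≡0 (subst (O v v ≤_) (Loopless.loopless-at adjacency-loopless v) (orients⇒≤ O-orients v v))
      N-vv : N v v ≡ 0
      N-vv = cong₂ _+_ O-vv (cong (_* δ v v) (trans (cong (k ∸_) out≡k) (n∸n≡0 k)))
    -- a 2-cycle v → σ v → v would use the edge v — σ v in both directions
    no-2-cycles : ∀ v → σ (σ v) ≡ v → σ v ≡ v
    no-2-cycles v σσv≡v with σ v ≟ v
    ... | yes σv≡v = σv≡v
    ... | no σv≢v  = ⊥-elim (<⇒≱ (subst (2 ≤_) (Orients.orients-at O-orients v (σ v)) (+-mono-≤ (arc-of-σ σv≢v) back))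
                                  (adjacency≤1 v (σ v)))
      where
      back : 1 ≤ O (σ v) v
      back = subst (λ c → 1 ≤ O (σ v) c) σσv≡v (arc-of-σ (σv≢v ∘ σ-injective))
    P : EdgePermutation G
    P = record
      { σ           = σ
      ; σ-injective = σ-injective
      ; no-2-cycles = no-2-cycles
      ; along-edges = λ v σv≢v → adjacency⇒edge (≤-trans (arc-of-σ σv≢v) (orients⇒≤ O-orients v (σ v)))
      }

  -- orient G so that every out-degree is ⌊deg/2⌋; the vertices of maximum degree are then saturated for k = ⌊Δ/2⌋
  max-degree-permutation : Eulerian G → HasEdge G →
    Σ (EdgePermutation G) λ P → ∀ v → degree G v ≡ maxDegree G → EdgePermutation.σ P v ≢ v
  max-degree-permutation eulerian (u , w , uw) =
    proj₁ saturated , λ v max → proj₂ saturated v (trans (out-degree v) (cong ⌊_/2⌋ max))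
    where
    orientation : BalancedOrientation (adjacency G)
    orientation = balanced-orientation adjacency-symmetric adjacency-loopless
                    (λ v → subst Even (degree≡rowSum v) (eulerian v))
    O = proj₁ orientation
    O-orients = proj₁ (proj₂ orientation)
    O-circulation = proj₂ (proj₂ orientation)
    out-degree : ∀ v → rowSum O v ≡ ⌊ degree G v /2⌋
    out-degree v = trans (n≡⌊n+n/2⌋ _)
                     (cong ⌊_/2⌋ (trans (degree-halves O-orients O-circulation v) (sym (degree≡rowSum v))))
    k = ⌊ maxDegree G /2⌋
    out≤k : ∀ v → rowSum O v ≤ k
    out≤k v = subst (_≤ k) (sym (out-degree v)) (⌊n/2⌋-mono (degree≤maxDegree v))
    k≥1 : 1 ≤ k
    k≥1 = ≤-trans (double≥1 (subst (1 ≤_) (sym (degree-halves O-orients O-circulation u)) deg-u≥1)) (out≤k u)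
      where
      deg-u≥1 : 1 ≤ rowSum (adjacency G) u
      deg-u≥1 = subst (_≤ rowSum (adjacency G) u) (edge⇒adjacency uw) (term≤sum (adjacency G u) w)
      double≥1 : ∀ {a} → 1 ≤ a + a → 1 ≤ a
      double≥1 {suc a} _ = s≤s z≤n
    saturated = saturated-permutation {{>-nonZero k≥1}} O-orients O-circulation out≤k

lemma3p3 : ∀ {n : ℕ} (G : Graph n) → Eulerian G → HasEdge G →
    Σ (List (Cycle G)) λ cs → VertexDisjoint cs ×
      (∀ (v : Fin n) → degree G v ≡ maxDegree G → Any (λ c → v ∈ vertices c) cs)
lemma3p3 {n} G eulerian has-edge = cycles , disjoint , λ v max → covers (∈-allFin v) (max-moved v max)
  where
  permutation = max-degree-permutation G eulerian has-edge
  max-moved = proj₂ permutation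
  open CycleCover (cycle-cover (proj₁ permutation) (allFin n))
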